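{- Let $C$ be an $m\times n$ binary $2$-covering array with columns $c^1,\dots,c^n$ such that $wt(c^i)\le\lfloor m/2\rfloor$ for all $i\in\{1,\dots,n\}$, and suppose $wt(c^j)<\lfloor m/2\rfloor$ for some index $j$. Then there is an $m\times n$ binary $2$-covering array $C'$ with columns $c'^1,\dots,c'^n$ such that $wt(c'^j)=\lfloor m/2\rfloor-1$, $wt(c'^i)=\lfloor m/2\rfloor$ for all $i\neq j$, and $\mathrm{supp}(c^i)\subseteq\mathrm{supp}(c'^i)$ for all $i\in\{1,\dots,n\}$.
   Context: A binary $t$-covering array of size $m$ and degree $n$ is an $m\times n$ matrix with entries in $\{0,1\}$ such that for any $t$ distinct columns, all $2^t$ binary vectors of length $t$ occur at least once as the restriction of some row to those columns. For a binary vector $u$, $\mathrm{supp}(u)=\{i: u_i\neq 0\}$ and $wt(u)=|\mathrm{supp}(u)|$. -}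

module Defs where

open import Data.Nat using (ℕ; zero; suc; _+_)
open import Data.Bool using (Bool; true; false)
open import Data.Fin using (Fin; zero; suc)
open import Data.Product using (∃; _×_)
open import Relation.Binary.PropositionalEquality using (_≡_; _≢_)

BinMatrix : ℕ → ℕ → Set
BinMatrix m n = Fin m → Fin n → Bool

BinVec : ℕ → Set
BinVec m = Fin m → Bool

column : ∀ {m n} → BinMatrix m n → Fin n → BinVec m
column C i r = C r i

wt : ∀ {m} → BinVec m → ℕ
wt {zero} u = 0
wt {suc m} u with u zero
... | true  = suc (wt (λ r → u (suc r)))
... | false = wt (λ r → u (suc r))

_⊆supp_ : ∀ {m} → BinVec m → BinVec m → Set
u ⊆supp v = ∀ r → u r ≡ true → v r ≡ true

Is2CoveringArray : ∀ {m n} → BinMatrix m n → Set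
Is2CoveringArray {m} {n} C =
  (i j : Fin n) → i ≢ j → (a b : Bool) → ∃ λ (r : Fin m) → C r i ≡ a × C r j ≡ b

module Submission where

-- Write f = ⌊m/2⌋.  Two columns u, v of a binary matrix with
-- wt u ≤ wt v and wt u + wt v ≤ m contain all four row patterns as soon as
-- they share a 1 and u ⊄ v: then v ⊄ u by counting, and the rows cannot all
-- lie in supp u ∪ supp v by inclusion–exclusion.  Sharing a 1 survives any
-- enlargement of supports, so it suffices to enlarge the columns to weight f
-- (column j to weight f ∸ 1) keeping them pairwise non-nested.
--
-- Columns i ≠ j are raised along the Greene–Kleitman symmetric chains of the
-- Boolean lattice: bracket matching leaves unmatched zeros, and 'raise k u'
-- turns k of them into ones.  Raising is undone by 'lower', and lowering
-- further only removes ones, so two vectors raised to the same vector are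
-- nested, which two distinct columns of a covering array never are.
-- Column j is replaced by the first f ∸ 1 rows, after permuting the rows so
-- that supp c^j comes first; lowering never destroys an initial run of ones
-- of a vector of weight ≤ m/2, so this column lies in no raised column.

open import Defs
open import Data.Nat using (ℕ; _≤_; _<_; _∸_; _/_)
open import Data.Fin using (Fin)
open import Data.Product using (∃; _×_)
open import Relation.Binary.PropositionalEquality using (_≡_; _≢_)

open import Data.Bool using (Bool; true; false; not; _∧_; _∨_; if_then_else_)
import Data.Bool.Properties as BoolP
open import Data.Empty using (⊥-elim)
open import Data.Fin using (zero; suc; toℕ; fromℕ<)
import Data.Fin.Properties as FinP
open import Data.Fin.Permutation as Perm
  using (Permutation; _⟨$⟩ʳ_; _⟨$⟩ˡ_; lift₀; transpose; _∘ₚ_)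
open import Data.Nat using (zero; suc; _+_; _*_; _<ᵇ_; _≤?_; z≤n; s≤s)
open import Data.Nat.DivMod using (m/n*n≤m)
open import Data.Nat.Properties
open import Data.Product using (_,_)
open import Data.Sum using (_⊎_; inj₁; inj₂)
open import Data.Vec.Functional using (_∷_; tail)
open import Function using (_∘_)
open import Relation.Binary.PropositionalEquality
  using (refl; sym; trans; cong; cong₂; subst; subst₂; _≗_; module ≡-Reasoning)
open import Relation.Nullary using (¬_; yes; no)
open import Relation.Nullary.Decidable using (_×-dec_)
open import Algebra.Properties.CommutativeSemigroup +-commutativeSemigroup
  using (interchange)
import Algebra.Properties.CommutativeMonoid.Sum +-0-commutativeMonoid as Sum

bit : Bool → ℕ
bit true  = 1
bit false = 0

wt-∷ : ∀ {m} (u : BinVec (suc m)) → wt u ≡ bit (u zero) + wt (tail u)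
wt-∷ u with u zero
... | true  = refl
... | false = refl

wt-≤ : ∀ {m} (u : BinVec m) → wt u ≤ m
wt-≤ {zero} u = z≤n
wt-≤ {suc m} u rewrite wt-∷ u with u zero
... | true  = s≤s (wt-≤ (tail u))
... | false = m≤n⇒m≤1+n (wt-≤ (tail u))

wt-pos : ∀ {m} (u : BinVec m) r → u r ≡ true → 0 < wt u
wt-pos {suc m} u zero ur rewrite wt-∷ u | ur = s≤s z≤n
wt-pos {suc m} u (suc r) ur rewrite wt-∷ u = ≤-trans (wt-pos (tail u) r ur) (m≤n+m _ _)

wt-full : ∀ {m} (u : BinVec m) → (∀ r → u r ≡ true) → wt u ≡ m
wt-full {zero} u full = refl
wt-full {suc m} u full rewrite wt-∷ u | full zero = cong suc (wt-full (tail u) (full ∘ suc))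

wt-mono : ∀ {m} (u v : BinVec m) → u ⊆supp v → wt u ≤ wt v
wt-mono {zero} u v u⊆v = z≤n
wt-mono {suc m} u v u⊆v rewrite wt-∷ u | wt-∷ v with u zero in u0 | v zero in v0
... | true  | true  = s≤s (wt-mono (tail u) (tail v) (u⊆v ∘ suc))
... | false | true  = m≤n⇒m≤1+n (wt-mono (tail u) (tail v) (u⊆v ∘ suc))
... | false | false = wt-mono (tail u) (tail v) (u⊆v ∘ suc)
... | true  | false with () ← trans (sym v0) (u⊆v zero u0)

⊆supp-wt-≗ : ∀ {m} (u v : BinVec m) → u ⊆supp v → wt v ≤ wt u → u ≗ v
⊆supp-wt-≗ {suc m} u v u⊆v v≤u rewrite wt-∷ u | wt-∷ v with u zero in u0 | v zero in v0
... | true  | false with () ← trans (sym v0) (u⊆v zero u0)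
... | false | true  = ⊥-elim (<⇒≱ v≤u (wt-mono (tail u) (tail v) (u⊆v ∘ suc)))
... | true  | true  = λ
  { zero    → trans u0 (sym v0)
  ; (suc r) → ⊆supp-wt-≗ (tail u) (tail v) (u⊆v ∘ suc) (≤-pred v≤u) r }
... | false | false = λ
  { zero    → trans u0 (sym v0)
  ; (suc r) → ⊆supp-wt-≗ (tail u) (tail v) (u⊆v ∘ suc) v≤u r }

_∪_ _∩_ : ∀ {m} → BinVec m → BinVec m → BinVec m
(u ∪ v) r = u r ∨ v r
(u ∩ v) r = u r ∧ v r

wt-∪-∩ : ∀ {m} (u v : BinVec m) → wt u + wt v ≡ wt (u ∪ v) + wt (u ∩ v)
wt-∪-∩ {zero} u v = refl
wt-∪-∩ {suc m} u v = begin
  wt u + wt v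
    ≡⟨ cong₂ _+_ (wt-∷ u) (wt-∷ v) ⟩
  (bit (u zero) + wt (tail u)) + (bit (v zero) + wt (tail v))
    ≡⟨ interchange (bit (u zero)) _ _ _ ⟩
  (bit (u zero) + bit (v zero)) + (wt (tail u) + wt (tail v))
    ≡⟨ cong₂ _+_ (bit-∪-∩ (u zero) (v zero)) (wt-∪-∩ (tail u) (tail v)) ⟩
  (bit ((u ∪ v) zero) + bit ((u ∩ v) zero)) + (wt (tail (u ∪ v)) + wt (tail (u ∩ v)))
    ≡⟨ interchange (bit ((u ∪ v) zero)) _ _ _ ⟩
  (bit ((u ∪ v) zero) + wt (tail (u ∪ v))) + (bit ((u ∩ v) zero) + wt (tail (u ∩ v)))
    ≡⟨ sym (cong₂ _+_ (wt-∷ (u ∪ v)) (wt-∷ (u ∩ v))) ⟩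
  wt (u ∪ v) + wt (u ∩ v) ∎
  where
  open ≡-Reasoning
  bit-∪-∩ : ∀ x y → bit x + bit y ≡ bit (x ∨ y) + bit (x ∧ y)
  bit-∪-∩ true  true  = refl
  bit-∪-∩ true  false = refl
  bit-∪-∩ false true  = refl
  bit-∪-∩ false false = refl

wt-cover-share : ∀ {m} (u v : BinVec m) → (∀ r → u r ≡ false → v r ≡ true) →
  (∃ λ r → u r ≡ true × v r ≡ true) → m < wt u + wt v
wt-cover-share {m} u v covered (r₀ , ur₀ , vr₀) = begin-strict
  m                       ≡⟨ sym (wt-full (u ∪ v) union-full) ⟩
  wt (u ∪ v)              <⟨ m<m+n _ (wt-pos (u ∩ v) r₀ meet) ⟩
  wt (u ∪ v) + wt (u ∩ v) ≡⟨ sym (wt-∪-∩ u v) ⟩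
  wt u + wt v             ∎
  where
  open ≤-Reasoning
  union-full : ∀ r → (u ∪ v) r ≡ true
  union-full r with u r in ur
  ... | true  = refl
  ... | false = covered r ur
  meet : (u ∩ v) r₀ ≡ true
  meet rewrite ur₀ | vr₀ = refl

Covers : ∀ {m} → BinVec m → BinVec m → Set
Covers u v = ∀ a b → ∃ λ r → u r ≡ a × v r ≡ b

covers-sym : ∀ {m} {u v : BinVec m} → Covers u v → Covers v u
covers-sym cov a b with cov b a
... | r , ur , vr = r , vr , ur

covers⇒⊈ : ∀ {m} {u v : BinVec m} → Covers u v → ¬ (u ⊆supp v)
covers⇒⊈ cov u⊆v with cov true false
... | r , ur , vr with () ← trans (sym vr) (u⊆v r ur)

occurs-unless : ∀ {m} (u v : BinVec m) a b →
  ¬ (∀ r → u r ≡ a → v r ≡ not b) → ∃ λ r → u r ≡ a × v r ≡ b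
occurs-unless u v a b excluded with FinP.any? (λ r → (u r BoolP.≟ a) ×-dec (v r BoolP.≟ b))
... | yes occurs = occurs
... | no absent  = ⊥-elim (excluded λ r ur → BoolP.¬-not (λ vr → absent (r , ur , vr)))

covers-by-weight : ∀ {m} (u v : BinVec m) → wt u + wt v ≤ m → wt u ≤ wt v →
  (∃ λ r → u r ≡ true × v r ≡ true) → ¬ (u ⊆supp v) → Covers u v
covers-by-weight u v light u≤v share u⊈v = covers
  where
  v⊈u : ¬ (∀ r → u r ≡ false → v r ≡ false)
  v⊈u excluded = u⊈v λ r ur → trans (same r) ur
    where
    v⊆u : v ⊆supp u
    v⊆u r vr with u r in ur
    ... | true  = refl
    ... | false with () ← trans (sym vr) (excluded r ur)
    same : v ≗ u
    same = ⊆supp-wt-≗ v u v⊆u u≤v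
  covers : Covers u v
  covers true  true  = share
  covers true  false = occurs-unless u v true false u⊈v
  covers false true  = occurs-unless u v false true v⊈u
  covers false false = occurs-unless u v false false
    (λ covered → <⇒≱ (wt-cover-share u v covered share) light)

-- Bracket matching, reading the rows from last to first: each 1 is matched
-- with the nearest pending 0 after it.  unmatched u counts the zeros of u
-- that stay unmatched.
unmatched : ∀ {m} → BinVec m → ℕ
unmatched {zero}  u = 0
unmatched {suc m} u =
  if u zero then unmatched (tail u) ∸ 1 else suc (unmatched (tail u))

-- raise k u turns the last k unmatched zeros of u into ones.
raise : ∀ {m} → ℕ → BinVec m → BinVec m
raise-∷ : ∀ {m} → Bool → ℕ → BinVec m → BinVec (suc m)
raise {zero}  k u = u
raise {suc m} k u = raise-∷ (u zero) k (tail u)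
raise-∷ true  k t = true ∷ raise k t
raise-∷ false k t with k ≤? unmatched t
... | yes _ = false ∷ raise k t
... | no  _ = true ∷ raise (k ∸ 1) t

-- lower k u turns the first k unmatched ones of u (ones with no unmatched
-- zero after them) back into zeros.
lower : ∀ {m} → ℕ → BinVec m → BinVec m
lower-∷ : ∀ {m} → Bool → ℕ → BinVec m → BinVec (suc m)
lower-free : ∀ {m} → ℕ → ℕ → BinVec m → BinVec (suc m)
lower {zero}  k u = u
lower {suc m} k u = lower-∷ (u zero) k (tail u)
lower-∷ false k       t = false ∷ lower k t
lower-∷ true  zero    t = true ∷ lower zero t
lower-∷ true  (suc k) t = lower-free (unmatched t) k t
lower-free zero    k t = false ∷ lower k t
lower-free (suc _) k t = true ∷ lower (suc k) t

unmatched-≗ : ∀ {m} {u v : BinVec m} → u ≗ v → unmatched u ≡ unmatched v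
unmatched-≗ {zero} e = refl
unmatched-≗ {suc m} {u} {v} e
  rewrite e zero | unmatched-≗ {m} {tail u} {tail v} (e ∘ suc) = refl

-- Every zero of u is either unmatched or matched with a one.
unmatched-bound : ∀ {m} (u : BinVec m) → m ≤ unmatched u + 2 * wt u
unmatched-bound {zero} u = z≤n
unmatched-bound {suc m} u with u zero | unmatched-bound (tail u)
... | false | ih = s≤s ih
... | true  | ih = ≤-trans (s≤s ih) (close (unmatched (tail u)) (wt (tail u)))
  where
  close : ∀ c w → suc (c + 2 * w) ≤ (c ∸ 1) + 2 * suc w
  close zero    w rewrite *-suc 2 w = s≤s (n≤1+n _)
  close (suc c) w = ≤-reflexive (begin
    suc (suc c + 2 * w)   ≡⟨ cong suc (sym (+-suc c (2 * w))) ⟩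
    suc (c + suc (2 * w)) ≡⟨ sym (+-suc c (suc (2 * w))) ⟩
    c + suc (suc (2 * w)) ≡⟨ cong (c +_) (sym (*-suc 2 w)) ⟩
    c + 2 * suc w         ∎)
    where open ≡-Reasoning

raise-wt : ∀ {m} k (u : BinVec m) → k ≤ unmatched u → wt (raise k u) ≡ wt u + k
raise-wt {zero} zero u _ = refl
raise-wt {suc m} k u k≤ with u zero
... | true = cong suc (raise-wt k (tail u) (≤-trans k≤ (m∸n≤m _ 1)))
... | false with k ≤? unmatched (tail u)
...   | yes k≤′ = raise-wt k (tail u) k≤′
...   | no  k≰ with k | k≤
...     | zero   | _        = ⊥-elim (k≰ z≤n)
...     | suc k′ | s≤s k′≤  =
          trans (cong suc (raise-wt k′ (tail u) k′≤)) (sym (+-suc _ _))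

raise-unmatched : ∀ {m} k (u : BinVec m) → k ≤ unmatched u →
  unmatched (raise k u) ≡ unmatched u ∸ k
raise-unmatched {zero} zero u _ = refl
raise-unmatched {suc m} k u k≤ with u zero
... | true rewrite raise-unmatched k (tail u) (≤-trans k≤ (m∸n≤m _ 1))
                 | ∸-+-assoc (unmatched (tail u)) k 1
                 | ∸-+-assoc (unmatched (tail u)) 1 k | +-comm k 1 = refl
... | false with k ≤? unmatched (tail u)
...   | yes k≤′ rewrite raise-unmatched k (tail u) k≤′ = sym (+-∸-assoc 1 k≤′)
...   | no  k≰ with k | k≤
...     | zero   | _       = ⊥-elim (k≰ z≤n)
...     | suc k′ | s≤s k′≤
          rewrite raise-unmatched k′ (tail u) k′≤
                | ≤-antisym k′≤ (≮⇒≥ (λ k′< → k≰ k′<))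
                | n∸n≡0 (unmatched (tail u)) = refl

raise-⊇ : ∀ {m} k (u : BinVec m) → u ⊆supp raise k u
raise-⊇ {suc m} k u zero ur with u zero
raise-⊇ {suc m} k u zero refl | true = refl
raise-⊇ {suc m} k u zero ()   | false
raise-⊇ {suc m} k u (suc r) ur with u zero
... | true = raise-⊇ k (tail u) r ur
... | false with k ≤? unmatched (tail u)
...   | yes _ = raise-⊇ k (tail u) r ur
...   | no  _ = raise-⊇ (k ∸ 1) (tail u) r ur

lower-≗ : ∀ {m} k {u v : BinVec m} → u ≗ v → lower k u ≗ lower k v
lower-≗ {suc m} k {u} {v} e r
  with u zero | v zero | e zero | unmatched-≗ {m} {tail u} {tail v} (e ∘ suc)
lower-≗ {suc m} k {u} {v} e zero    | false | false | refl | _ = refl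
lower-≗ {suc m} k {u} {v} e (suc r) | false | false | refl | _ = lower-≗ k (e ∘ suc) r
lower-≗ {suc m} zero {u} {v} e zero    | true | true | refl | _ = refl
lower-≗ {suc m} zero {u} {v} e (suc r) | true | true | refl | _ = lower-≗ zero (e ∘ suc) r
lower-≗ {suc m} (suc k) {u} {v} e r | true | true | refl | same rewrite same
  with unmatched (tail v) | r
... | zero  | zero  = refl
... | zero  | suc r = lower-≗ k (e ∘ suc) r
... | suc _ | zero  = refl
... | suc _ | suc r = lower-≗ (suc k) (e ∘ suc) r

lower-raise : ∀ {m} k (u : BinVec m) → k ≤ unmatched u → lower k (raise k u) ≗ u
lower-raise {suc m} k u k≤ r with u zero in u0
lower-raise {suc m} zero u k≤ r | true with r
... | zero  = sym u0
... | suc r = lower-raise zero (tail u) z≤n r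
lower-raise {suc m} (suc k) u k≤ r | true
  rewrite raise-unmatched (suc k) (tail u) (≤-trans k≤ (m∸n≤m _ 1))
  with unmatched (tail u) | k≤
... | suc (suc c) | s≤s k≤′ rewrite +-∸-assoc 1 k≤′ with r
...   | zero  = sym u0
...   | suc r = lower-raise (suc k) (tail u) (≤-trans k≤ (m∸n≤m _ 1)) r
lower-raise {suc m} k u k≤ r | false with k ≤? unmatched (tail u)
... | yes k≤′ with r
...   | zero  = sym u0
...   | suc r = lower-raise k (tail u) k≤′ r
lower-raise {suc m} k u k≤ r | false | no k≰ with k | k≤
... | zero   | _ = ⊥-elim (k≰ z≤n)
... | suc k′ | s≤s k′≤
      rewrite raise-unmatched k′ (tail u) k′≤
            | m≤n⇒m∸n≡0 (≮⇒≥ (λ k′< → k≰ k′<)) with r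
...   | zero  = sym u0
...   | suc r = lower-raise k′ (tail u) k′≤ r

lower-antitone : ∀ {m} {l k} (z : BinVec m) → l ≤ k → lower k z ⊆supp lower l z
lower-antitone {suc m} {l} {k} z l≤k r e with z zero
lower-antitone {suc m} z l≤k zero    e | false = e
lower-antitone {suc m} z l≤k (suc r) e | false = lower-antitone (tail z) l≤k r e
lower-antitone {suc m} {zero} {zero} z l≤k zero    e | true = refl
lower-antitone {suc m} {zero} {zero} z l≤k (suc r) e | true = lower-antitone (tail z) l≤k r e
lower-antitone {suc m} {zero} {suc k} z l≤k r e | true with unmatched (tail z) | r
... | zero  | zero  = refl
... | zero  | suc r = lower-antitone (tail z) z≤n r e
... | suc _ | zero  = refl
... | suc _ | suc r = lower-antitone (tail z) z≤n r e
lower-antitone {suc m} {suc l} {suc k} z (s≤s l≤k) r e | true with unmatched (tail z) | r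
... | zero  | zero  = e
... | zero  | suc r = lower-antitone (tail z) l≤k r e
... | suc _ | zero  = refl
... | suc _ | suc r = lower-antitone (tail z) (s≤s l≤k) r e

raise-≗-⊆ : ∀ {m} {k l} (u v : BinVec m) → k ≤ unmatched u → l ≤ unmatched v →
  raise k u ≗ raise l v → l ≤ k → u ⊆supp v
raise-≗-⊆ {k = k} {l} u v k≤ l≤ same l≤k r ur =
  trans (sym (lower-raise l v l≤ r))
    (lower-antitone (raise l v) l≤k r
      (trans (sym (lower-≗ k same r)) (trans (lower-raise k u k≤ r) ur)))

-- Vectors raised to the same vector lie on one chain, so they are nested.
raise-nested : ∀ {m} {k l} (u v : BinVec m) → k ≤ unmatched u → l ≤ unmatched v →
  raise k u ≗ raise l v → u ⊆supp v ⊎ v ⊆supp u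
raise-nested {k = k} {l} u v k≤ l≤ same with ≤-total l k
... | inj₁ l≤k = inj₁ (raise-≗-⊆ u v k≤ l≤ same l≤k)
... | inj₂ k≤l = inj₂ (raise-≗-⊆ v u l≤ k≤ (sym ∘ same) k≤l)

raise-room : ∀ {m} f (u : BinVec m) → wt u ≤ f → 2 * f ≤ m → f ∸ wt u ≤ unmatched u
raise-room f u w≤f 2f≤m = ≤-trans (m≤m+n d (d + 0)) 2d≤c
  where
  d = f ∸ wt u
  2f≡2d+2w : 2 * f ≡ 2 * d + 2 * wt u
  2f≡2d+2w = trans (cong (2 *_) (sym (m∸n+n≡m w≤f))) (*-distribˡ-+ 2 d (wt u))
  2d≤c : 2 * d ≤ unmatched u
  2d≤c = +-cancelʳ-≤ (2 * wt u) (2 * d) (unmatched u)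
    (≤-trans (≤-reflexive (sym 2f≡2d+2w)) (≤-trans 2f≤m (unmatched-bound u)))

initial : ∀ {m} → ℕ → BinVec m
initial k r = toℕ r <ᵇ k

initial-< : ∀ {m} k (r : Fin m) → initial k r ≡ true → toℕ r < k
initial-< (suc k) zero    _ = s≤s z≤n
initial-< (suc k) (suc r) e = s≤s (initial-< k r e)

<-initial : ∀ {m} k (r : Fin m) → toℕ r < k → initial k r ≡ true
<-initial (suc k) zero    _       = refl
<-initial (suc k) (suc r) (s≤s r<k) = <-initial k r r<k

initial-mono : ∀ {m} {k l} → k ≤ l → initial {m} k ⊆supp initial l
initial-mono {k = k} {l} k≤l r e = <-initial l r (≤-trans (initial-< k r e) k≤l)

wt-initial : ∀ {m} k → k ≤ m → wt (initial {m} k) ≡ k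
wt-initial {zero}  zero    _         = refl
wt-initial {suc m} zero    _         = wt-initial {m} zero z≤n
wt-initial {suc m} (suc k) (s≤s k≤m) = cong suc (wt-initial k k≤m)

-- Lowering never removes an initial run of ones from a vector of weight at
-- most m/2: the tail is light enough to keep an unmatched zero, which the
-- first one of the run is matched with.
lower-initial : ∀ {m} s (u : BinVec m) → 2 * wt u ≤ m → initial s ⊆supp u →
  ∀ k → initial s ⊆supp lower k u
lower-initial {suc m} (suc s) u light sub k r e =
  subst (λ b → lower-∷ b k (tail u) r ≡ true) (sym (sub zero refl)) (kept k r e)
  where
  tail-light : suc (2 * wt (tail u)) ≤ m
  tail-light = ≤-pred (subst (_≤ suc m)
    (trans (cong (λ w → 2 * w) (trans (wt-∷ u) (cong (λ b → bit b + wt (tail u)) (sub zero refl))))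
           (*-suc 2 (wt (tail u))))
    light)
  kept : ∀ k r → initial (suc s) r ≡ true → lower-∷ true k (tail u) r ≡ true
  kept zero zero    _ = refl
  kept zero (suc r) e = lower-initial s (tail u) (≤-trans (n≤1+n _) tail-light) (sub ∘ suc) zero r e
  kept (suc k) r e with unmatched (tail u) | unmatched-bound (tail u)
  ... | zero  | bound = ⊥-elim (<⇒≱ tail-light bound)
  ... | suc _ | _ with r
  ...   | zero  = refl
  ...   | suc r = lower-initial s (tail u) (≤-trans (n≤1+n _) tail-light) (sub ∘ suc) (suc k) r e

initial-⊆-raise : ∀ {m} s k (u : BinVec m) → k ≤ unmatched u → 2 * wt (raise k u) ≤ m →
  initial s ⊆supp raise k u → initial s ⊆supp u
initial-⊆-raise s k u room light sub r e =
  trans (sym (lower-raise k u room r)) (lower-initial s (raise k u) light sub k r e)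

permuteRows : ∀ {m n} → Permutation m m → BinMatrix m n → BinMatrix m n
permuteRows π C r = C (π ⟨$⟩ʳ r)

-- Some reordering of the rows moves the support of u into the first wt u
-- rows: sort the tail, and if the first row is 0 swap it behind the support.
sortRows-< : ∀ {m} (u : BinVec m) →
  ∃ λ (π : Permutation m m) → ∀ r → u (π ⟨$⟩ʳ r) ≡ true → toℕ r < wt u
sortRows-< {zero}  u = Perm.id , λ ()
sortRows-< {suc m} u with sortRows-< (tail u) | u zero in u0
... | π , below | true  = lift₀ π , λ { zero _ → s≤s z≤n ; (suc r) e → s≤s (below r e) }
... | π , below | false = transpose zero last ∘ₚ lift₀ π , bound
  where
  W = wt (tail u)
  last : Fin (suc m)
  last = fromℕ< (s≤s (wt-≤ (tail u)))
  toℕ-last : toℕ last ≡ W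
  toℕ-last = FinP.toℕ-fromℕ< (s≤s (wt-≤ (tail u)))
  lifted : ∀ r → u (lift₀ π ⟨$⟩ʳ r) ≡ true → 0 < toℕ r × toℕ r ≤ W
  lifted zero    e with () ← trans (sym u0) e
  lifted (suc r) e = s≤s z≤n , below r e
  bound : ∀ r → u (lift₀ π ⟨$⟩ʳ (transpose zero last ⟨$⟩ʳ r)) ≡ true → toℕ r < W
  bound r e with r FinP.≟ zero
  ... | yes refl with lifted last e
  ...   | pos , _ = ≤-trans pos (≤-reflexive toℕ-last)
  bound r e | no _ with r FinP.≟ last
  ...   | yes refl with () ← trans (sym u0) e
  ...   | no r≢last with lifted r e
  ...     | _ , r≤W = ≤∧≢⇒< r≤W (λ r≡W → r≢last (FinP.toℕ-injective (trans r≡W (sym toℕ-last))))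

sortRows : ∀ {m} (u : BinVec m) →
  ∃ λ (π : Permutation m m) → (λ r → u (π ⟨$⟩ʳ r)) ⊆supp initial (wt u)
sortRows u with sortRows-< u
... | π , below = π , λ r e → <-initial _ r (below r e)

wt-sum : ∀ {m} (u : BinVec m) → wt u ≡ Sum.sum (bit ∘ u)
wt-sum {zero}  u = refl
wt-sum {suc m} u = trans (wt-∷ u) (cong (bit (u zero) +_) (wt-sum (tail u)))

wt-permute : ∀ {m} (π : Permutation m m) (u : BinVec m) → wt (λ r → u (π ⟨$⟩ʳ r)) ≡ wt u
wt-permute π u =
  trans (wt-sum (λ r → u (π ⟨$⟩ʳ r)))
    (trans (sym (Sum.sum-permute (bit ∘ u) π)) (sym (wt-sum u)))

permuteRows-covering : ∀ {m n} (π : Permutation m m) (C : BinMatrix m n) →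
  Is2CoveringArray C → Is2CoveringArray (permuteRows π C)
permuteRows-covering π C cov i k i≢k a b with cov i k i≢k a b
... | r , p , q = π ⟨$⟩ˡ r
                , subst (λ x → C x i ≡ a) (sym (Perm.inverseʳ π)) p
                , subst (λ x → C x k ≡ b) (sym (Perm.inverseʳ π)) q

BalancedExtension : ∀ {m n} → BinMatrix m n → Fin n → BinMatrix m n → Set
BalancedExtension {m} {n} C j C′ = Is2CoveringArray C′ ×
  wt (column C′ j) ≡ m / 2 ∸ 1 ×
  ((i : Fin n) → i ≢ j → wt (column C′ i) ≡ m / 2) ×
  ((i : Fin n) → column C i ⊆supp column C′ i)

extension-unpermute : ∀ {m n} (π : Permutation m m) {C D : BinMatrix m n} {j : Fin n} →
  BalancedExtension (permuteRows π C) j D →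
  BalancedExtension C j (permuteRows (Perm.flip π) D)
extension-unpermute π {C} {D} (cov , wt-j , wt-i , sub) =
  permuteRows-covering (Perm.flip π) D cov ,
  trans (wt-permute (Perm.flip π) (column D _)) wt-j ,
  (λ i i≢j → trans (wt-permute (Perm.flip π) (column D i)) (wt-i i i≢j)) ,
  (λ i r e → sub i (π ⟨$⟩ˡ r) (subst (λ x → C x i ≡ true) (sym (Perm.inverseʳ π)) e))

module SortedCase {m n} (C : BinMatrix m n) (cov : Is2CoveringArray C)
  (light : (i : Fin n) → wt (column C i) ≤ m / 2) (j : Fin n)
  (sorted : column C j ⊆supp initial (m / 2 ∸ 1)) where

  f : ℕ
  f = m / 2

  2f≤m : 2 * f ≤ m
  2f≤m = ≤-trans (≤-reflexive (*-comm 2 f)) (m/n*n≤m m 2)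

  f+f≤m : f + f ≤ m
  f+f≤m = ≤-trans (≤-reflexive (cong (f +_) (sym (+-identityʳ f)))) 2f≤m

  room : ∀ i → f ∸ wt (column C i) ≤ unmatched (column C i)
  room i = raise-room f (column C i) (light i) 2f≤m

  raised : Fin n → BinVec m
  raised i = raise (f ∸ wt (column C i)) (column C i)

  wt-raised : ∀ i → wt (raised i) ≡ f
  wt-raised i = trans (raise-wt _ (column C i) (room i)) (m+[n∸m]≡n (light i))

  raised-⊇ : ∀ i → column C i ⊆supp raised i
  raised-⊇ i = raise-⊇ _ (column C i)

  shared : ∀ {u v : BinVec m} {i k} → column C i ⊆supp u → column C k ⊆supp v → i ≢ k →
    ∃ λ r → u r ≡ true × v r ≡ true
  shared {i = i} {k} i⊆u k⊆v i≢k with cov i k i≢k true true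
  ... | r , ir , kr = r , i⊆u r ir , k⊆v r kr

  -- Distinct raised columns are not nested, since their originals are not.
  raised-covers : ∀ i k → i ≢ k → Covers (raised i) (raised k)
  raised-covers i k i≢k =
    covers-by-weight (raised i) (raised k)
      (subst (_≤ m) (sym (cong₂ _+_ (wt-raised i) (wt-raised k))) f+f≤m)
      (≤-reflexive (trans (wt-raised i) (sym (wt-raised k))))
      (shared (raised-⊇ i) (raised-⊇ k) i≢k) not-nested
    where
    not-nested : ¬ (raised i ⊆supp raised k)
    not-nested i⊆k with raise-nested (column C i) (column C k) (room i) (room k)
      (⊆supp-wt-≗ (raised i) (raised k) i⊆k (≤-reflexive (trans (wt-raised k) (sym (wt-raised i)))))
    ... | inj₁ C-i⊆k = covers⇒⊈ (cov i k i≢k) C-i⊆k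
    ... | inj₂ C-k⊆i = covers⇒⊈ (cov k i (i≢k ∘ sym)) C-k⊆i

  first : BinVec m
  first = initial (f ∸ 1)

  wt-first : wt first ≡ f ∸ 1
  wt-first = wt-initial (f ∸ 1) (≤-trans (m∸n≤m f 1) (≤-trans (m≤m+n f f) f+f≤m))

  -- The first rows lie in no raised column k ≠ j, as they contain column j
  -- and the original column k does not.
  first-covers : ∀ k → k ≢ j → Covers first (raised k)
  first-covers k k≢j =
    covers-by-weight first (raised k)
      (subst (_≤ m) (sym (cong₂ _+_ wt-first (wt-raised k))) (≤-trans (+-monoˡ-≤ f (m∸n≤m f 1)) f+f≤m))
      (subst₂ _≤_ (sym wt-first) (sym (wt-raised k)) (m∸n≤m f 1))
      (shared sorted (raised-⊇ k) (k≢j ∘ sym)) not-nested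
    where
    not-nested : ¬ (first ⊆supp raised k)
    not-nested first⊆k = covers⇒⊈ (cov j k (k≢j ∘ sym))
      (λ r e → initial-⊆-raise (f ∸ 1) _ (column C k) (room k)
        (subst (λ w → 2 * w ≤ m) (sym (wt-raised k)) 2f≤m) first⊆k r (sorted r e))

  column′ : Fin n → BinVec m
  column′ i with i FinP.≟ j
  ... | yes _ = first
  ... | no  _ = raised i

  C′ : BinMatrix m n
  C′ r i = column′ i r

  extension : BalancedExtension C j C′
  extension = covering , wt-j , wt-i , support
    where
    covering : Is2CoveringArray C′
    covering i k i≢k with i FinP.≟ j | k FinP.≟ j
    ... | yes i≡j | yes k≡j = ⊥-elim (i≢k (trans i≡j (sym k≡j)))
    ... | yes _   | no  k≢j = first-covers k k≢j
    ... | no  i≢j | yes _   = covers-sym (first-covers i i≢j)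
    ... | no  _   | no  _   = raised-covers i k i≢k
    wt-j : wt (column C′ j) ≡ f ∸ 1
    wt-j with j FinP.≟ j
    ... | yes _   = wt-first
    ... | no  j≢j = ⊥-elim (j≢j refl)
    wt-i : ∀ i → i ≢ j → wt (column C′ i) ≡ f
    wt-i i i≢j with i FinP.≟ j
    ... | yes i≡j = ⊥-elim (i≢j i≡j)
    ... | no  _   = wt-raised i
    support : ∀ i → column C i ⊆supp column C′ i
    support i with i FinP.≟ j
    ... | yes refl = sorted
    ... | no  _    = raised-⊇ i

corollary3p2 : (m n : ℕ) (C : BinMatrix m n) → Is2CoveringArray C →
    ((i : Fin n) → wt (column C i) ≤ m / 2) →
    (j : Fin n) → wt (column C j) < m / 2 →
    ∃ λ (C′ : BinMatrix m n) → Is2CoveringArray C′ ×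
      wt (column C′ j) ≡ m / 2 ∸ 1 ×
      ((i : Fin n) → i ≢ j → wt (column C′ i) ≡ m / 2) ×
      ((i : Fin n) → column C i ⊆supp column C′ i)
corollary3p2 m n C cov light j lighter with sortRows (column C j)
... | π , sorted = permuteRows (Perm.flip π) C′ , extension-unpermute π extension
  where
  sortedπ : column (permuteRows π C) j ⊆supp initial (m / 2 ∸ 1)
  sortedπ r e = initial-mono (∸-monoˡ-≤ 1 lighter) r (sorted r e)
  open SortedCase (permuteRows π C) (permuteRows-covering π C cov)
    (λ i → subst (_≤ m / 2) (sym (wt-permute π (column C i))) (light i)) j sortedπ
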